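{- Let $q$ be a prime power, $r^*=q^3-q$, $u^*=q^3+q^2$, and let $\Omega_{r,s_1,\dots,s_{q-1},t_1,\dots,t_{q-1},u}$ be as in the context. If $0\le t_\nu<q^2+q$ for $1\le\nu\le q-1$, then \[\#\Omega_{r^*,0,\dots,0,t_1,\dots,t_{q-1},u^*}=\#\Omega_{r^*,0,\dots,0,0,\dots,0,u^*}+\sum_{\nu=1}^{q-1}t_\nu,\] where in both sets all $s_\mu$ are $0$.
   Context: $q$ is a power of a prime. For integers $r,s_1,\dots,s_{q-1},t_1,\dots,t_{q-1},u$, $\Omega_{r,s_1,\dots,s_{q-1},t_1,\dots,t_{q-1},u}$ is the set of $(i,j_1,\dots,j_{q-1},k_1,\dots,k_{q-1})\in\mathbb{Z}^{2q-1}$ with $-r\le i$; $-s_\mu\le i+(q^2+q)k_\mu<-s_\mu+(q^2+q)$ for $1\le\mu\le q-1$; $-t_\nu\le qi+(q^2+q)j_\nu-(q+1)\sum_{\mu=1}^{q-1}k_\mu<-t_\nu+(q^2+q)$ for $1\le\nu\le q-1$; $-u\le -q^2i-(q^2+q)\sum_{\nu}j_\nu-(q+1)\sum_\mu k_\mu$. -}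

module Defs where

open import Data.Nat as ℕ using (ℕ; suc)
open import Data.Nat.Primality using (Prime)
open import Data.Integer as ℤ using (ℤ; +_; -_; _+_; _*_; _-_; _≤_; _<_; 0ℤ)
open import Data.Vec using (Vec; []; _∷_; foldr′; replicate; zip; map)
open import Data.Vec.Relation.Unary.All using (All)
open import Data.Product using (Σ; ∃; _×_; _,_)
open import Relation.Binary.PropositionalEquality using (_≡_)
open import Function.Bundles using (_↔_)
open import Data.Fin using (Fin)

IsPrimePower : ℕ → Set
IsPrimePower q = Σ ℕ λ p → Σ ℕ λ k → Prime p × q ≡ p ℕ.^ suc k

sumℤ : ∀ {n} → Vec ℤ n → ℤ
sumℤ = foldr′ _+_ 0ℤ

QQ : ℕ → ℤ
QQ q = + (q ℕ.* q ℕ.+ q)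

InΩ : (q : ℕ) → let n = q ℕ.∸ 1 in
      ℤ → Vec ℤ n → Vec ℤ n → ℤ → ℤ × Vec ℤ n × Vec ℤ n → Set
InΩ q r s t u (i , j , k) =
    (- r ≤ i)
  × All (λ { (sμ , kμ) → (- sμ ≤ i + Q * kμ) × (i + Q * kμ < - sμ + Q) }) (zip s k)
  × All (λ { (tν , jν) → (- tν ≤ L jν) × (L jν < - tν + Q) }) (zip t j)
  × (- u ≤ - (+ q * + q * i) - Q * sumℤ j - (+ q + + 1) * sumℤ k)
  where
    Q = QQ q
    L : ℤ → ℤ
    L jν = + q * i + Q * jν - (+ q + + 1) * sumℤ k

Ω : (q : ℕ) → let n = q ℕ.∸ 1 in ℤ → Vec ℤ n → Vec ℤ n → ℤ → Set
Ω q r s t u = Σ (ℤ × Vec ℤ (q ℕ.∸ 1) × Vec ℤ (q ℕ.∸ 1)) (InΩ q r s t u)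

HasCard : Set → ℕ → Set
HasCard A N = A ↔ Fin N

rStar uStar : ℕ → ℤ
rStar q = + (q ℕ.^ 3) - + q
uStar q = + (q ℕ.^ 3 ℕ.+ q ℕ.^ 2)

-- With all s_μ = 0, every k_μ and j_ν is confined to a window of length
-- Q = q² + q, so a point of Ω is determined by its first coordinate i, and Ω is
-- in bijection with a finite set of admissible integers i (the u-constraint
-- bounds i from above).  Raising one t_ν by 1 (keeping it below Q) lowers j_ν
-- by 1 exactly for those i at which q i + Q j_ν - (q+1) Σk sits at the top of
-- its window; there the last expression of Ω grows by Q, elsewhere it is
-- unchanged.  So the admissible set only gains the i at the top whose last
-- expression lay in [-u-Q, -u); there is exactly one such i (an explicit
-- construction, and a divisibility argument for uniqueness).  Hence each unit
-- of Σ t adds exactly one point.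
module Submission where

open import Data.Nat as ℕ using (ℕ; zero; suc; NonZero)
import Data.Nat.Properties as ℕP
open import Data.Nat.Tactic.RingSolver using () renaming (solve-∀ to ℕ-solve-∀)
open import Data.Fin using (Fin; zero; suc; toℕ; fromℕ<)
import Data.Fin.Properties as FinP
open import Data.Bool using (if_then_else_)
open import Data.Empty using (⊥-elim)
open import Data.Product using (Σ; ∃₂; _×_; _,_; proj₁; proj₂)
open import Data.Product.Properties using (Σ-≡,≡→≡)
open import Data.Sum using (_⊎_; inj₁; inj₂)
open import Data.Sum.Function.Propositional using (_⊎-↔_)
open import Data.Vec using (Vec; []; _∷_; replicate; map; zip; lookup; updateAt; sum)
import Data.Vec.Properties as VecP
open import Data.Vec.Relation.Unary.All as All using (All; []; _∷_)
import Data.Vec.Relation.Unary.All.Properties as AllP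
open import Function using (_∘_)
open import Function.Bundles using (_↔_; _⇔_; mk↔ₛ′; mk⇔; module Equivalence)
open import Function.Properties.Inverse using (↔-trans; ↔-sym)
open import Level using (0ℓ)
open import Relation.Nullary using (Dec; yes; no; does; ¬_; Irrelevant; contradiction)
open import Relation.Nullary.Decidable using (does-⇔; dec-true; dec-false; _×-dec_)
open import Relation.Unary using (Pred; Decidable)
open import Relation.Binary.PropositionalEquality
open import Defs

private
  variable
    n N : ℕ
    A B : Set
    R R′ : Pred (Fin N) 0ℓ

count : Decidable R → ℕ
count {zero}  R? = 0
count {suc N} R? = (if does (R? zero) then 1 else 0) ℕ.+ count (R? ∘ suc)

Dec↔Fin : ∀ {A : Set} (a? : Dec A) → Irrelevant A → A ↔ Fin (if does a? then 1 else 0)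
Dec↔Fin (yes a) irr = mk↔ₛ′ (λ _ → zero) (λ _ → a) (λ { zero → refl }) (irr a)
Dec↔Fin (no ¬a) irr = mk↔ₛ′ (⊥-elim ∘ ¬a) (λ ()) (λ ()) (⊥-elim ∘ ¬a)

Σ-Fin-suc↔⊎ : Σ (Fin (suc N)) R ↔ (R zero ⊎ Σ (Fin N) (R ∘ suc))
Σ-Fin-suc↔⊎ {N = N} {R = R} = mk↔ₛ′ to from to-from from-to
  where
  to : Σ (Fin (suc N)) R → R zero ⊎ Σ (Fin N) (R ∘ suc)
  to (zero  , r) = inj₁ r
  to (suc k , r) = inj₂ (k , r)
  from : R zero ⊎ Σ (Fin N) (R ∘ suc) → Σ (Fin (suc N)) R
  from (inj₁ r)       = zero , r
  from (inj₂ (k , r)) = suc k , r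
  to-from : ∀ y → to (from y) ≡ y
  to-from (inj₁ r)       = refl
  to-from (inj₂ (k , r)) = refl
  from-to : ∀ x → from (to x) ≡ x
  from-to (zero  , r) = refl
  from-to (suc k , r) = refl

Σ↔count : (R? : Decidable R) → (∀ k → Irrelevant (R k)) → Σ (Fin N) R ↔ Fin (count R?)
Σ↔count {zero}  R? irr = mk↔ₛ′ (λ ()) (λ ()) (λ ()) (λ ())
Σ↔count {suc N} R? irr =
  ↔-trans Σ-Fin-suc↔⊎
    (↔-trans (Dec↔Fin (R? zero) (irr zero) ⊎-↔ Σ↔count (R? ∘ suc) (irr ∘ suc))
      (↔-sym FinP.+↔⊎))

count-cong : (R? : Decidable R) (R′? : Decidable R′) →
             (∀ k → R k → R′ k) → (∀ k → R′ k → R k) → count R? ≡ count R′?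
count-cong {zero}  R? R′? to from = refl
count-cong {suc N} R? R′? to from =
  cong₂ (λ b c → (if b then 1 else 0) ℕ.+ c)
    (does-⇔ (mk⇔ (to zero) (from zero)) (R? zero) (R′? zero))
    (count-cong (R? ∘ suc) (R′? ∘ suc) (to ∘ suc) (from ∘ suc))

count-suc : (R? : Decidable R) (R′? : Decidable R′) (k* : Fin N) → R′ k* → ¬ R k* →
            (∀ k → R k → R′ k) → (∀ k → k ≢ k* → R′ k → R k) → count R′? ≡ suc (count R?)
count-suc R? R′? zero r′ ¬r to from
  rewrite dec-true (R′? zero) r′ | dec-false (R? zero) ¬r =
  cong suc (count-cong (R′? ∘ suc) (R? ∘ suc) (λ k → from (suc k) (λ ())) (to ∘ suc))
count-suc R? R′? (suc k*) r′ ¬r to from =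
  trans (cong₂ (λ b c → (if b then 1 else 0) ℕ.+ c)
           (does-⇔ (mk⇔ (from zero (λ ())) (to zero)) (R′? zero) (R? zero))
           (count-suc (R? ∘ suc) (R′? ∘ suc) k* r′ ¬r (to ∘ suc)
              (λ k k≢k* → from (suc k) (k≢k* ∘ FinP.suc-injective))))
        (ℕP.+-suc _ (count (R? ∘ suc)))

sum-updateAt-suc : ∀ (t : Vec ℕ n) ν → sum (updateAt t ν suc) ≡ suc (sum t)
sum-updateAt-suc (x ∷ t) zero    = refl
sum-updateAt-suc (x ∷ t) (suc ν) = trans (cong (x ℕ.+_) (sum-updateAt-suc t ν)) (ℕP.+-suc x (sum t))

sum≡0⇒replicate : ∀ (t : Vec ℕ n) → sum t ≡ 0 → t ≡ replicate n 0
sum≡0⇒replicate []       _   = refl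
sum≡0⇒replicate (0 ∷ t) eq = cong (0 ∷_) (sum≡0⇒replicate t eq)

sum≡suc⇒updateAt : ∀ (t : Vec ℕ n) {N} → sum t ≡ suc N → ∃₂ λ t₀ ν → updateAt t₀ ν suc ≡ t
sum≡suc⇒updateAt (suc x ∷ t) _  = x ∷ t , zero , refl
sum≡suc⇒updateAt (zero  ∷ t) eq with sum≡suc⇒updateAt t eq
... | t₀ , ν , refl = 0 ∷ t₀ , suc ν , refl

All-<-updateAt-suc⁻ : ∀ {B} (t : Vec ℕ n) ν → All (ℕ._< B) (updateAt t ν suc) → All (ℕ._< B) t
All-<-updateAt-suc⁻ (x ∷ t) zero    (x+1<B ∷ t<B) = ℕP.<-trans (ℕP.n<1+n x) x+1<B ∷ t<B
All-<-updateAt-suc⁻ (x ∷ t) (suc ν) (x<B ∷ t<B)   = x<B ∷ All-<-updateAt-suc⁻ t ν t<B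

module LatticePoints where

  open import Data.Integer as ℤ
    using (ℤ; +_; -_; _+_; _*_; _-_; _≤_; _<_; 0ℤ; +≤+; +<+; ∣_∣; _/ℕ_; _%ℕ_)
  open import Data.Integer.DivMod using (a≡a%ℕn+[a/ℕn]*n; n%ℕd<d)
  import Data.Integer.Properties as ℤP
  open import Algebra.Properties.AbelianGroup ℤP.+-0-abelianGroup using () renaming (∙-cancelʳ to +-cancelʳ)
  open import Data.Integer.Tactic.RingSolver using (solve-∀)

  -- Linear inequalities are proved by writing the gap as a sum of non-negative terms;
  -- the identity behind it is checked by the ring solver.
  i<j⇒0≤j-i-1 : ∀ {i j} → i < j → 0ℤ ≤ j - i - + 1
  i<j⇒0≤j-i-1 {i} {j} i<j = subst (0ℤ ≤_) (gap i j) (ℤP.i≤j⇒0≤j-i (ℤP.i<j⇒suc[i]≤j i<j))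
    where
    gap : ∀ i j → j - (+ 1 + i) ≡ j - i - + 1
    gap = solve-∀

  ≤-from-0≤ : ∀ {i j e} → 0ℤ ≤ e → e ≡ j - i → i ≤ j
  ≤-from-0≤ 0≤e refl = ℤP.0≤i-j⇒j≤i 0≤e

  <-from-0≤ : ∀ {i j e} → 0ℤ ≤ e → e ≡ j - i - + 1 → i < j
  <-from-0≤ {i} {j} 0≤e refl = ℤP.suc[i]≤j⇒i<j (ℤP.0≤i-j⇒j≤i (subst (0ℤ ≤_) (gap i j) 0≤e))
    where
    gap : ∀ i j → j - i - + 1 ≡ j - (+ 1 + i)
    gap = solve-∀

  0≤+ : ∀ n → 0ℤ ≤ + n
  0≤+ n = +≤+ ℕ.z≤n

  0≤i+j : ∀ {i j} → 0ℤ ≤ i → 0ℤ ≤ j → 0ℤ ≤ i + j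
  0≤i+j = ℤP.+-mono-≤

  0≤+n*i : ∀ n {i} → 0ℤ ≤ i → 0ℤ ≤ + n * i
  0≤+n*i n {+ k} _ = subst (0ℤ ≤_) (ℤP.pos-* n k) (0≤+ (n ℕ.* k))

  module Window (d : ℕ) .{{_ : NonZero d}} where

    D : ℤ
    D = + d

    InWindow : ℤ → ℤ → Set
    InWindow lo v = lo ≤ v × v < lo + D

    -- the unique y with InWindow lo (x + D * y)
    window : ℤ → ℤ → ℤ
    window lo x = - ((x - lo) /ℕ d)

    window-residue : ∀ lo x → x + D * window lo x ≡ lo + + ((x - lo) %ℕ d)
    window-residue lo x = begin
      x + D * - y                 ≡⟨ identity x lo y D ⟩
      lo + ((x - lo) - y * D)     ≡⟨ cong (λ e → lo + (e - y * D)) (a≡a%ℕn+[a/ℕn]*n (x - lo) d) ⟩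
      lo + ((r + y * D) - y * D)  ≡⟨ cancel lo r y D ⟩
      lo + r                      ∎
      where
      open ≡-Reasoning
      y = (x - lo) /ℕ d
      r = + ((x - lo) %ℕ d)
      identity : ∀ x lo y D → x + D * - y ≡ lo + ((x - lo) - y * D)
      identity = solve-∀
      cancel : ∀ lo r y D → lo + ((r + y * D) - y * D) ≡ lo + r
      cancel = solve-∀

    window-≥ : ∀ lo x → lo ≤ x + D * window lo x
    window-≥ lo x rewrite window-residue lo x = ℤP.i≤i+j lo (+ ((x - lo) %ℕ d))

    window-< : ∀ lo x → x + D * window lo x < lo + D
    window-< lo x rewrite window-residue lo x = ℤP.+-monoʳ-< lo (+<+ (n%ℕd<d (x - lo) d))

    window-inWindow : ∀ lo x → InWindow lo (x + D * window lo x)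
    window-inWindow lo x = window-≥ lo x , window-< lo x

    multiple-in-window : ∀ {lo a b c} → InWindow lo a → InWindow lo b → a - b ≡ D * c → c ≡ 0ℤ
    multiple-in-window {lo} {a} {b} {c} (lo≤a , a<hi) (lo≤b , b<hi) a-b≡Dc = ℤP.≤-antisym c≤0 0≤c
      where
      c<1 : c < + 1
      c<1 = ℤP.*-cancelˡ-<-nonNeg D (<-from-0≤ (0≤i+j (i<j⇒0≤j-i-1 a<hi) (ℤP.i≤j⇒0≤j-i lo≤b))
              (trans (gap₁ lo a b D) (cong (λ e → D * + 1 - e - + 1) a-b≡Dc)))
        where
        gap₁ : ∀ lo a b D → (lo + D - a - + 1) + (b - lo) ≡ D * + 1 - (a - b) - + 1
        gap₁ = solve-∀
      -1<c : - + 1 < c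
      -1<c = ℤP.*-cancelˡ-<-nonNeg D (<-from-0≤ (0≤i+j (i<j⇒0≤j-i-1 b<hi) (ℤP.i≤j⇒0≤j-i lo≤a))
              (trans (gap₂ lo a b D) (cong (λ e → e - D * - + 1 - + 1) a-b≡Dc)))
        where
        gap₂ : ∀ lo a b D → (lo + D - b - + 1) + (a - lo) ≡ (a - b) - D * - + 1 - + 1
        gap₂ = solve-∀
      c≤0 : c ≤ 0ℤ
      c≤0 = ≤-from-0≤ (i<j⇒0≤j-i-1 c<1) (gap₃ c)
        where
        gap₃ : ∀ c → + 1 - c - + 1 ≡ 0ℤ - c
        gap₃ = solve-∀
      0≤c : 0ℤ ≤ c
      0≤c = ≤-from-0≤ (i<j⇒0≤j-i-1 -1<c) (gap₄ c)
        where
        gap₄ : ∀ c → c - - + 1 - + 1 ≡ c - 0ℤ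
        gap₄ = solve-∀

    window-unique : ∀ lo x {y} → InWindow lo (x + D * y) → y ≡ window lo x
    window-unique lo x {y} in-window = ℤP.i-j≡0⇒i≡j y (window lo x)
      (multiple-in-window in-window (window-inWindow lo x) (difference x D y (window lo x)))
      where
      difference : ∀ x D y w → (x + D * y) - (x + D * w) ≡ D * (y - w)
      difference = solve-∀

    window-shift : ∀ lo x z → window lo (x + D * z) ≡ window lo x - z
    window-shift lo x z = sym (window-unique lo (x + D * z)
      (subst (InWindow lo) (sym (shifted x D z (window lo x))) (window-inWindow lo x)))
      where
      shifted : ∀ x D z w → (x + D * z) + D * (w - z) ≡ x + D * w
      shifted = solve-∀

    window-pred-top : ∀ lo x → x + D * window lo x ≡ lo + D - + 1 →
                      window (lo - + 1) x ≡ window lo x - + 1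
    window-pred-top lo x top = sym (window-unique (lo - + 1) x
      (ℤP.≤-reflexive (sym lands-at-lo-1) ,
       subst (_< lo - + 1 + D) (sym lands-at-lo-1) (<-from-0≤ 0≤D-1 (gap lo D))))
      where
      0≤D-1 : 0ℤ ≤ D - + 1
      0≤D-1 = ≤-from-0≤ (i<j⇒0≤j-i-1 (+<+ (ℕ.>-nonZero⁻¹ d))) (minus-zero D)
        where
        minus-zero : ∀ D → D - 0ℤ - + 1 ≡ D - + 1 - 0ℤ
        minus-zero = solve-∀
      gap : ∀ lo D → D - + 1 ≡ lo - + 1 + D - (lo - + 1) - + 1
      gap = solve-∀
      lands-at-lo-1 : x + D * (window lo x - + 1) ≡ lo - + 1
      lands-at-lo-1 = begin
        x + D * (window lo x - + 1)   ≡⟨ identity x D (window lo x) ⟩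
        (x + D * window lo x) - D     ≡⟨ cong (_- D) top ⟩
        lo + D - + 1 - D              ≡⟨ cancel lo D ⟩
        lo - + 1                      ∎
        where
        open ≡-Reasoning
        identity : ∀ x D w → x + D * (w - + 1) ≡ (x + D * w) - D
        identity = solve-∀
        cancel : ∀ lo D → lo + D - + 1 - D ≡ lo - + 1
        cancel = solve-∀

    window-pred-not-top : ∀ lo x → x + D * window lo x ≢ lo + D - + 1 →
                          window (lo - + 1) x ≡ window lo x
    window-pred-not-top lo x not-top = sym (window-unique (lo - + 1) x
      (ℤP.≤-trans (ℤP.i-j≤i lo (+ 1)) (window-≥ lo x) ,
       subst (x + D * window lo x <_) (rearrange lo D)
        (ℤP.≤∧≢⇒< (subst (x + D * window lo x ≤_) (ℤP.+-comm (- + 1) (lo + D))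
                     (ℤP.i<j⇒i≤pred[j] (window-< lo x))) not-top)))
      where
      rearrange : ∀ lo D → lo + D - + 1 ≡ lo - + 1 + D
      rearrange = solve-∀

    window-nonPos : ∀ {lo x} → lo ≤ 0ℤ → 0ℤ ≤ x → window lo x ≤ 0ℤ
    window-nonPos {lo} {x} lo≤0 0≤x = ≤-from-0≤ (i<j⇒0≤j-i-1 w<1) (identity w)
      where
      w = window lo x
      w<1 : w < + 1
      w<1 = ℤP.*-cancelˡ-<-nonNeg D (<-from-0≤
        (0≤i+j (0≤i+j (i<j⇒0≤j-i-1 (window-< lo x)) (ℤP.i≤j⇒0≤j-i lo≤0)) 0≤x) (gap lo x D w))
        where
        gap : ∀ lo x D w → ((lo + D) - (x + D * w) - + 1) + (0ℤ - lo) + x ≡ D * + 1 - D * w - + 1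
        gap = solve-∀
      identity : ∀ w → + 1 - w - + 1 ≡ 0ℤ - w
      identity = solve-∀

  module Interval (lo : ℤ) (N : ℕ) where

    at : Fin N → ℤ
    at k = lo + + toℕ k

    at-injective : ∀ {k k′} → at k ≡ at k′ → k ≡ k′
    at-injective {k} {k′} eq = FinP.toℕ-injective (ℤP.+-injective (begin
      + toℕ k          ≡⟨ cancel lo (+ toℕ k) ⟩
      at k - lo        ≡⟨ cong (_- lo) eq ⟩
      at k′ - lo       ≡⟨ cancel lo (+ toℕ k′) ⟨
      + toℕ k′         ∎))
      where
      open ≡-Reasoning
      cancel : ∀ lo x → x ≡ (lo + x) - lo
      cancel = solve-∀

    index : ∀ {i} → lo ≤ i → i < lo + + N → Fin N
    index {i} lo≤i i<hi = fromℕ< (ℤP.drop‿+<+ (subst (_< + N) (sym (ℤP.0≤i⇒+∣i∣≡i (ℤP.i≤j⇒0≤j-i lo≤i))) i-lo<N))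
      where
      i-lo<N : i - lo < + N
      i-lo<N = subst (i - lo <_) (cancel lo (+ N)) (ℤP.+-monoˡ-< (- lo) i<hi)
        where
        cancel : ∀ lo n → lo + n - lo ≡ n
        cancel = solve-∀

    at-index : ∀ {i} (lo≤i : lo ≤ i) (i<hi : i < lo + + N) → at (index lo≤i i<hi) ≡ i
    at-index {i} lo≤i i<hi = begin
      lo + + toℕ (index lo≤i i<hi)  ≡⟨ cong (λ n → lo + + n) (FinP.toℕ-fromℕ< _) ⟩
      lo + + ∣ i - lo ∣             ≡⟨ cong (λ x → lo + x) (ℤP.0≤i⇒+∣i∣≡i (ℤP.i≤j⇒0≤j-i lo≤i)) ⟩
      lo + (i - lo)                 ≡⟨ cancel lo i ⟩
      i                             ∎
      where
      open ≡-Reasoning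
      cancel : ∀ lo i → lo + (i - lo) ≡ i
      cancel = solve-∀

    module _ {P : Pred ℤ 0ℓ} (inside : ∀ {i} → P i → lo ≤ i × i < lo + + N) where

      Σ↔Σ-at : (∀ i → Irrelevant (P i)) → Σ ℤ P ↔ Σ (Fin N) (P ∘ at)
      Σ↔Σ-at P-irr = mk↔ₛ′ to from to-from from-to
        where
        to : Σ ℤ P → Σ (Fin N) (P ∘ at)
        to (i , p) = index (proj₁ (inside p)) (proj₂ (inside p)) ,
                     subst P (sym (at-index (proj₁ (inside p)) (proj₂ (inside p)))) p
        from : Σ (Fin N) (P ∘ at) → Σ ℤ P
        from (k , p) = at k , p
        from-to : ∀ x → from (to x) ≡ x
        from-to (i , p) = Σ-≡,≡→≡ (at-index (proj₁ (inside p)) (proj₂ (inside p)) , P-irr i _ p)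
        to-from : ∀ y → to (from y) ≡ y
        to-from (k , p) = Σ-≡,≡→≡ (at-injective (at-index (proj₁ (inside p)) (proj₂ (inside p))) , P-irr (at k) _ p)

    count-at-suc : ∀ {P P′ : Pred ℤ 0ℓ} (P? : Decidable P) (P′? : Decidable P′) →
                   (∀ {i} → P′ i → lo ≤ i × i < lo + + N) → ∀ {i*} → P′ i* → ¬ P i* →
                   (∀ i → P i → P′ i) → (∀ i → i ≢ i* → P′ i → P i) →
                   count (P′? ∘ at) ≡ suc (count (P? ∘ at))
    count-at-suc {P} {P′} P? P′? inside′ {i*} p′* ¬p* grow shrink =
      count-suc (P? ∘ at) (P′? ∘ at) k* (subst P′ (sym k*-at) p′*) (¬p* ∘ subst P k*-at) (grow ∘ at)
        (λ k k≢k* → shrink (at k) (λ at-k≡i* → k≢k* (at-injective (trans at-k≡i* (sym k*-at)))))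
      where
      k* : Fin N
      k* = index (proj₁ (inside′ p′*)) (proj₂ (inside′ p′*))
      k*-at : at k* ≡ i*
      k*-at = at-index (proj₁ (inside′ p′*)) (proj₂ (inside′ p′*))

  sumℤ-replicate : ∀ n c → sumℤ (replicate n c) ≡ + n * c
  sumℤ-replicate zero    c = refl
  sumℤ-replicate (suc n) c = trans (cong (λ s → c + s) (sumℤ-replicate n c)) (identity (+ n) c)
    where
    identity : ∀ n c → c + n * c ≡ (+ 1 + n) * c
    identity = solve-∀

  sumℤ-map-shift : ∀ (f : A → ℤ) z (xs : Vec A n) → sumℤ (map (λ x → f x - z) xs) ≡ sumℤ (map f xs) - + n * z
  sumℤ-map-shift f z []            = refl
  sumℤ-map-shift f z (_∷_ {n} x xs) =
    trans (cong (λ s → f x - z + s) (sumℤ-map-shift f z xs)) (identity (f x) (sumℤ (map f xs)) (+ n) z)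
    where
    identity : ∀ a s n z → (a - z) + (s - n * z) ≡ (a + s) - (+ 1 + n) * z
    identity = solve-∀

  sumℤ-map-updateAt : ∀ (f : A → ℤ) (g : A → A) (xs : Vec A n) ν →
                      sumℤ (map f (updateAt xs ν g)) + f (lookup xs ν) ≡ sumℤ (map f xs) + f (g (lookup xs ν))
  sumℤ-map-updateAt f g (x ∷ xs) zero = swap (f (g x)) (sumℤ (map f xs)) (f x)
    where
    swap : ∀ a s b → (a + s) + b ≡ (b + s) + a
    swap = solve-∀
  sumℤ-map-updateAt f g (x ∷ xs) (suc ν) = begin
    (f x + sumℤ (map f (updateAt xs ν g))) + f (lookup xs ν)  ≡⟨ ℤP.+-assoc (f x) _ _ ⟩
    f x + (sumℤ (map f (updateAt xs ν g)) + f (lookup xs ν))  ≡⟨ cong (λ s → f x + s) (sumℤ-map-updateAt f g xs ν) ⟩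
    f x + (sumℤ (map f xs) + f (g (lookup xs ν)))             ≡⟨ ℤP.+-assoc (f x) _ _ ⟨
    (f x + sumℤ (map f xs)) + f (g (lookup xs ν))             ∎
    where open ≡-Reasoning

  sumℤ-map-lower : ∀ c b (f : A → ℤ) {xs : Vec A n} → All (λ x → b ≤ c * f x) xs → + n * b ≤ c * sumℤ (map f xs)
  sumℤ-map-lower c b f [] = ≤-from-0≤ (0≤+ 0) (identity c)
    where
    identity : ∀ c → 0ℤ ≡ c * 0ℤ - 0ℤ
    identity = solve-∀
  sumℤ-map-lower c b f {_∷_ {n} x xs} (b≤cfx ∷ rest) =
    ≤-from-0≤ (0≤i+j (ℤP.i≤j⇒0≤j-i b≤cfx) (ℤP.i≤j⇒0≤j-i (sumℤ-map-lower c b f rest)))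
      (identity c b (f x) (sumℤ (map f xs)) (+ n))
    where
    identity : ∀ c b a s n → (c * a - b) + (c * s - n * b) ≡ c * (a + s) - (+ 1 + n) * b
    identity = solve-∀

  sumℤ-map-nonPos : ∀ (f : A → ℤ) → (∀ x → f x ≤ 0ℤ) → (xs : Vec A n) → sumℤ (map f xs) ≤ 0ℤ
  sumℤ-map-nonPos f f≤0 []       = ℤP.≤-refl
  sumℤ-map-nonPos f f≤0 (x ∷ xs) = ℤP.+-mono-≤ (f≤0 x) (sumℤ-map-nonPos f f≤0 xs)

  module _ {P : Pred (A × B) 0ℓ} (g : A → B) where

    All-zip⇒≡map : (∀ {a b} → P (a , b) → b ≡ g a) → ∀ {xs : Vec A n} {ys} → All P (zip xs ys) → ys ≡ map g xs
    All-zip⇒≡map forced {[]}     {[]}     []       = refl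
    All-zip⇒≡map forced {x ∷ xs} {y ∷ ys} (p ∷ ps) = cong₂ _∷_ (forced p) (All-zip⇒≡map forced ps)

    All-zip-map⁺ : (∀ a → P (a , g a)) → (xs : Vec A n) → All P (zip xs (map g xs))
    All-zip-map⁺ p []       = []
    All-zip-map⁺ p (x ∷ xs) = p x ∷ All-zip-map⁺ p xs

  module _ {C : Set} {P : Pred (A × B) 0ℓ} (h : C → A) (g : C → B) where

    All-zip-map-map⁺ : (∀ c → P (h c , g c)) → (cs : Vec C n) → All P (zip (map h cs) (map g cs))
    All-zip-map-map⁺ p []       = []
    All-zip-map-map⁺ p (c ∷ cs) = p c ∷ All-zip-map-map⁺ p cs

  module Geometry (m : ℕ) where

    q Qn : ℕ
    q  = suc m
    Qn = q ℕ.* q ℕ.+ q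

    open Window Qn renaming (D to Q) public

    r u : ℤ
    r = rStar q
    u = uStar q

    r≡q³-q : r ≡ + q * + q * + q - + q
    r≡q³-q = cong (_- + q) (trans (cong +_ (cube q)) (trans (ℤP.pos-* (q ℕ.* q) q) (cong (_* + q) (ℤP.pos-* q q))))
      where
      -- q ℕ.^ 3 unfolds to the left-hand side; the solver does not know _^_
      cube : ∀ q → q ℕ.* (q ℕ.* (q ℕ.* 1)) ≡ q ℕ.* q ℕ.* q
      cube = ℕ-solve-∀

    u≡q*Q : u ≡ + q * Q
    u≡q*Q = trans (cong +_ (factor q)) (ℤP.pos-* q Qn)
      where
      factor : ∀ q → q ℕ.* (q ℕ.* (q ℕ.* 1)) ℕ.+ q ℕ.* (q ℕ.* 1) ≡ q ℕ.* (q ℕ.* q ℕ.+ q)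
      factor = ℕ-solve-∀

    zeros : Vec ℤ m
    zeros = replicate m 0ℤ

    Ωₜ : Vec ℕ m → Set
    Ωₜ t = Ω q r zeros (map +_ t) u

    ks : ℤ → Vec ℤ m
    ks i = map (λ s → window (- s) i) zeros

    X : ℤ → ℤ
    X i = + q * i - (+ q + + 1) * sumℤ (ks i)

    js : Vec ℕ m → ℤ → Vec ℤ m
    js t i = map (λ tν → window (- + tν) (X i)) t

    E : Vec ℕ m → ℤ → ℤ
    E t i = - (+ q * + q * i) - Q * sumℤ (js t i) - (+ q + + 1) * sumℤ (ks i)

    Admissible : Vec ℕ m → Pred ℤ 0ℓ
    Admissible t i = - r ≤ i × - u ≤ E t i

    Admissible? : ∀ t → Decidable (Admissible t)
    Admissible? t i = (- r ℤP.≤? i) ×-dec (- u ℤP.≤? E t i)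

    Admissible-irrelevant : ∀ t i → Irrelevant (Admissible t i)
    Admissible-irrelevant t i (a , b) (a′ , b′) = cong₂ _,_ (ℤP.≤-irrelevant a a′) (ℤP.≤-irrelevant b b′)

    InΩ-irrelevant : ∀ t x → Irrelevant (InΩ q r zeros (map +_ t) u x)
    InΩ-irrelevant t x (a , b , c , d) (a′ , b′ , c′ , d′) =
      cong₂ _,_ (ℤP.≤-irrelevant a a′)
        (cong₂ _,_ (All.irrelevant window-irrelevant b b′)
          (cong₂ _,_ (All.irrelevant window-irrelevant c c′) (ℤP.≤-irrelevant d d′)))
      where
      window-irrelevant : ∀ {lo y hi} → Irrelevant (lo ≤ y × y < hi)
      window-irrelevant (p₁ , p₂) (p₁′ , p₂′) = cong₂ _,_ (ℤP.≤-irrelevant p₁ p₁′) (ℤP.<-irrelevant p₂ p₂′)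

    j-affine : ∀ i y → + q * i + Q * y - (+ q + + 1) * sumℤ (ks i) ≡ X i + Q * y
    j-affine i y = rearrange (+ q * i) (Q * y) ((+ q + + 1) * sumℤ (ks i))
      where
      rearrange : ∀ a b c → a + b - c ≡ (a - c) + b
      rearrange = solve-∀

    forced-k : ∀ t {i j k} → InΩ q r zeros (map +_ t) u (i , j , k) → k ≡ ks i
    forced-k t {i} (_ , k-ok , _ , _) =
      All-zip⇒≡map (λ s → window (- s) i) (λ {s} → window-unique (- s) i) k-ok

    forced-j : ∀ t {i j} → InΩ q r zeros (map +_ t) u (i , j , ks i) → j ≡ js t i
    forced-j t {i} (_ , _ , j-ok , _) =
      trans (All-zip⇒≡map (λ τ → window (- τ) (X i))
               (λ {τ} {y} → window-unique (- τ) (X i) ∘ subst (InWindow (- τ)) (j-affine i y)) j-ok)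
            (sym (VecP.map-∘ (λ τ → window (- τ) (X i)) +_ t))

    forced : ∀ t {i j k} → InΩ q r zeros (map +_ t) u (i , j , k) → (j , k) ≡ (js t i , ks i)
    forced t {i} {j} {k} inΩ =
      cong₂ _,_ (forced-j t (subst (λ k → InΩ q r zeros (map +_ t) u (i , j , k)) k≡ inΩ)) k≡
      where
      k≡ : k ≡ ks i
      k≡ = forced-k t inΩ

    ks-inWindow : ∀ i s → InWindow (- s) (i + Q * window (- s) i)
    ks-inWindow i s = window-inWindow (- s) i

    js-inWindow : ∀ i τ → let w = window (- + τ) (X i) in
                  InWindow (- + τ) (+ q * i + Q * w - (+ q + + 1) * sumℤ (ks i))
    js-inWindow i τ = subst (InWindow (- + τ)) (sym (j-affine i _)) (window-inWindow (- + τ) (X i))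

    forced-in-Ω : ∀ t {i} → Admissible t i → InΩ q r zeros (map +_ t) u (i , js t i , ks i)
    forced-in-Ω t {i} (r≤i , u≤E) =
      r≤i ,
      All-zip-map⁺ (λ s → window (- s) i) (ks-inWindow i) zeros ,
      All-zip-map-map⁺ +_ (λ τ → window (- + τ) (X i)) (js-inWindow i) t ,
      u≤E

    Ω↔Admissible : ∀ t → Ωₜ t ↔ Σ ℤ (Admissible t)
    Ω↔Admissible t = mk↔ₛ′ to from to-from from-to
      where
      to : Ωₜ t → Σ ℤ (Admissible t)
      to ((i , j , k) , inΩ@(r≤i , _ , _ , u≤)) =
        i , r≤i , subst (λ (j , k) → - u ≤ - (+ q * + q * i) - Q * sumℤ j - (+ q + + 1) * sumℤ k) (forced t inΩ) u≤
      from : Σ ℤ (Admissible t) → Ωₜ t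
      from (i , adm) = (i , js t i , ks i) , forced-in-Ω t adm
      to-from : ∀ y → to (from y) ≡ y
      to-from (i , adm) = cong (i ,_) (Admissible-irrelevant t i _ adm)
      from-to : ∀ x → from (to x) ≡ x
      from-to ((i , j , k) , inΩ) =
        Σ-≡,≡→≡ (cong (i ,_) (sym (forced t inΩ)) , InΩ-irrelevant t (i , j , k) _ inΩ)

    K : ℤ → ℤ
    K i = window 0ℤ i

    sumℤ-ks : ∀ i → sumℤ (ks i) ≡ + m * K i
    sumℤ-ks i = trans (cong sumℤ (VecP.map-replicate (λ s → window (- s) i) 0ℤ m)) (sumℤ-replicate m (K i))

    js-lower : ∀ i {τ} → τ ℕ.< Qn → + 1 - Q - X i ≤ Q * window (- + τ) (X i)
    js-lower i {τ} τ<Q = ≤-from-0≤ (0≤i+j (ℤP.i≤j⇒0≤j-i (window-≥ (- + τ) (X i))) (i<j⇒0≤j-i-1 (+<+ τ<Q)))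
      (identity (+ τ) (X i) (window (- + τ) (X i)) Q)
      where
      identity : ∀ τ x w Q → (x + Q * w - - τ) + (Q - τ - + 1) ≡ Q * w - (+ 1 - Q - x)
      identity = solve-∀

    Admissible⇒≤ : ∀ {t} → All (ℕ._< Qn) t → ∀ {i} → Admissible t i → i ≤ u + + m * (Q - + 1)
    Admissible⇒≤ {t} t<Q {i} (_ , u≤E) =
      ≤-from-0≤ (0≤i+j (0≤i+j (ℤP.i≤j⇒0≤j-i u≤E) (ℤP.i≤j⇒0≤j-i Σjs-lower)) (0≤+n*i m (window-≥ 0ℤ i)))
        (certificate (+ m) i (K i) (sumℤ (js t i)) u (sumℤ (ks i)) (sumℤ-ks i))
      where
      Σjs-lower : + m * (+ 1 - Q - X i) ≤ Q * sumℤ (js t i)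
      Σjs-lower = sumℤ-map-lower Q (+ 1 - Q - X i) (λ τ → window (- + τ) (X i)) (All.map (js-lower i) t<Q)
      certificate : ∀ n i k s u sk → sk ≡ n * k → let q = + 1 + n ; Q = q * q + q in
        ((- (q * q * i) - Q * s - (q + + 1) * sk) - - u) + (Q * s - n * (+ 1 - Q - (q * i - (q + + 1) * sk)))
          + n * (i + Q * k) ≡ (u + n * (Q - + 1)) - i
      certificate n i k s u .(n * k) refl = identity n i k s u
        where
        identity : ∀ n i k s u → let q = + 1 + n ; Q = q * q + q in
          ((- (q * q * i) - Q * s - (q + + 1) * (n * k)) - - u) + (Q * s - n * (+ 1 - Q - (q * i - (q + + 1) * (n * k))))
            + n * (i + Q * k) ≡ (u + n * (Q - + 1)) - i
        identity = solve-∀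

    span : ℕ
    span = ∣ u + + m * (Q - + 1) + r + + 1 ∣

    open Interval (- r) span public

    Admissible-inside : ∀ {t} → All (ℕ._< Qn) t → ∀ {i} → Admissible t i → - r ≤ i × i < - r + + span
    Admissible-inside t<Q adm@(r≤i , _) =
      r≤i , ℤP.<-≤-trans (<-from-0≤ (ℤP.i≤j⇒0≤j-i (Admissible⇒≤ t<Q adm)) (identity u (+ m) Q r _))
                         (ℤP.+-monoʳ-≤ (- r) (i≤+∣i∣ (u + + m * (Q - + 1) + r + + 1)))
      where
      identity : ∀ u m Q r i → (u + m * (Q - + 1)) - i ≡ (- r + (u + m * (Q - + 1) + r + + 1)) - i - + 1
      identity = solve-∀
      i≤+∣i∣ : ∀ i → i ≤ + ∣ i ∣
      i≤+∣i∣ (+ n)      = ℤP.≤-refl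
      i≤+∣i∣ (ℤ.-[1+ n ]) = ℤ.-≤+

    #Admissible : Vec ℕ m → ℕ
    #Admissible t = count (Admissible? t ∘ at)

    Ω-card : ∀ {t} → All (ℕ._< Qn) t → HasCard (Ωₜ t) (#Admissible t)
    Ω-card {t} t<Q =
      ↔-trans (Ω↔Admissible t)
        (↔-trans (Σ↔Σ-at (Admissible-inside t<Q) (Admissible-irrelevant t))
                 (Σ↔count (Admissible? t ∘ at) (Admissible-irrelevant t ∘ at)))

  module Increment (m : ℕ) (t : Vec ℕ m) (ν : Fin m) where

    open Geometry m

    a : ℕ
    a = lookup t ν

    t′ : Vec ℕ m
    t′ = updateAt t ν suc

    -- the largest value of X i + Q * j_ν allowed by the constraint on j_ν
    C : ℤ
    C = - + a + Q - + 1

    Top : ℤ → Set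
    Top i = X i + Q * window (- + a) (X i) ≡ C

    private
      pred-neg : ∀ a → - + a - + 1 ≡ - + suc a
      pred-neg a = identity (+ a)
        where
        identity : ∀ a → - a - + 1 ≡ - (+ 1 + a)
        identity = solve-∀

    Σjs-step : ∀ i → sumℤ (js t′ i) + window (- + a) (X i) ≡ sumℤ (js t i) + window (- + suc a) (X i)
    Σjs-step i = sumℤ-map-updateAt (λ τ → window (- + τ) (X i)) suc t ν

    E-step-top : ∀ i → Top i → E t′ i ≡ E t i + Q
    E-step-top i top = begin
      - (+ q * + q * i) - Q * sumℤ (js t′ i) - (+ q + + 1) * sumℤ (ks i)
        ≡⟨ cong (λ s → - (+ q * + q * i) - Q * s - (+ q + + 1) * sumℤ (ks i)) Σjs′ ⟩
      - (+ q * + q * i) - Q * (sumℤ (js t i) - + 1) - (+ q + + 1) * sumℤ (ks i)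
        ≡⟨ identity (- (+ q * + q * i)) Q (sumℤ (js t i)) ((+ q + + 1) * sumℤ (ks i)) ⟩
      E t i + Q  ∎
      where
      open ≡-Reasoning
      w = window (- + a) (X i)
      Σjs′ : sumℤ (js t′ i) ≡ sumℤ (js t i) - + 1
      Σjs′ = +-cancelʳ w _ _ (trans (Σjs-step i) (trans
               (cong (λ v → sumℤ (js t i) + v) (trans (cong (λ lo → window lo (X i)) (sym (pred-neg a)))
                                                       (window-pred-top (- + a) (X i) top)))
               (shuffle (sumℤ (js t i)) w)))
        where
        shuffle : ∀ s w → s + (w - + 1) ≡ (s - + 1) + w
        shuffle = solve-∀
      identity : ∀ A Q s c → A - Q * (s - + 1) - c ≡ (A - Q * s - c) + Q
      identity = solve-∀

    E-step-not-top : ∀ i → ¬ Top i → E t′ i ≡ E t i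
    E-step-not-top i not-top =
      cong (λ s → - (+ q * + q * i) - Q * s - (+ q + + 1) * sumℤ (ks i))
        (+-cancelʳ (window (- + a) (X i)) _ _ (trans (Σjs-step i)
          (cong (λ v → sumℤ (js t i) + v) (trans (cong (λ lo → window lo (X i)) (sym (pred-neg a)))
                                                 (window-pred-not-top (- + a) (X i) not-top)))))

    X-K : ∀ i → X i ≡ + q * i - (+ q + + 1) * (+ m * K i)
    X-K i = cong (λ s → + q * i - (+ q + + 1) * s) (sumℤ-ks i)

    Fresh : ℤ → Set
    Fresh i = Top i × InWindow (- u - Q) (E t i)

    fresh⇔ : ∀ {e} → (- u ≤ e + Q × e < - u) ⇔ InWindow (- u - Q) e
    fresh⇔ {e} = mk⇔ (λ (lo , hi) → ≤-from-0≤ (ℤP.i≤j⇒0≤j-i lo) (sym (identity₁ e Q u)) , subst (e <_) (identity₂ u Q) hi)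
                     (λ (lo , hi) → ≤-from-0≤ (ℤP.i≤j⇒0≤j-i lo) (identity₁ e Q u) , subst (e <_) (sym (identity₂ u Q)) hi)
      where
      identity₁ : ∀ e Q u → e - (- u - Q) ≡ (e + Q) - - u
      identity₁ = solve-∀
      identity₂ : ∀ u Q → - u ≡ - u - Q + Q
      identity₂ = solve-∀

    new-admissible⇒fresh : ∀ {i} → Admissible t′ i → ¬ Admissible t i → Fresh i
    new-admissible⇒fresh {i} (-r≤i , -u≤E′) not-adm with X i + Q * window (- + a) (X i) ℤP.≟ C
    ... | yes top    = top , Equivalence.to fresh⇔ (subst (- u ≤_) (E-step-top i top) -u≤E′ ,
                                                    ℤP.≰⇒> (not-adm ∘ (-r≤i ,_)))
    ... | no not-top = contradiction (-r≤i , subst (- u ≤_) (E-step-not-top i not-top) -u≤E′) not-adm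

    fresh⇒new-admissible : ∀ {i} → - r ≤ i → Fresh i → Admissible t′ i × ¬ Admissible t i
    fresh⇒new-admissible {i} -r≤i (top , in-window) =
      (-r≤i , subst (- u ≤_) (sym (E-step-top i top)) -u≤E+Q) , λ (_ , -u≤E) → ℤP.<⇒≱ E<-u -u≤E
      where
      -u≤E+Q : - u ≤ E t i + Q
      -u≤E+Q = proj₁ (Equivalence.from fresh⇔ in-window)
      E<-u : E t i < - u
      E<-u = proj₂ (Equivalence.from fresh⇔ in-window)

    top-offset : ℤ → ℤ → ℤ
    top-offset i₁ i₂ = window (- + a) (X i₂) - window (- + a) (X i₁)

    X-at-top : ∀ i₁ i₂ → Top i₁ → Top i₂ → X i₁ ≡ X i₂ + Q * top-offset i₁ i₂
    X-at-top i₁ i₂ top₁ top₂ = ℤP.i-j≡0⇒i≡j (X i₁) (X i₂ + Q * top-offset i₁ i₂)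
      (trans (identity (X i₁) (X i₂) Q (window (- + a) (X i₁)) (window (- + a) (X i₂)))
             (ℤP.i≡j⇒i-j≡0 (trans top₁ (sym top₂))))
      where
      identity : ∀ x₁ x₂ Q w₁ w₂ → x₁ - (x₂ + Q * (w₂ - w₁)) ≡ (x₁ + Q * w₁) - (x₂ + Q * w₂)
      identity = solve-∀

    X-K-at-top : ∀ i₁ i₂ → Top i₁ → Top i₂ →
                 (+ q * i₁ - (+ q + + 1) * (+ m * K i₁)) - ((+ q * i₂ - (+ q + + 1) * (+ m * K i₂)) + Q * top-offset i₁ i₂) ≡ 0ℤ
    X-K-at-top i₁ i₂ top₁ top₂ =
      trans (cong₂ (λ x₁ x₂ → x₁ - (x₂ + Q * top-offset i₁ i₂)) (sym (X-K i₁)) (sym (X-K i₂)))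
            (ℤP.i≡j⇒i-j≡0 (X-at-top i₁ i₂ top₁ top₂))

    E-at-top : ∀ i₁ i₂ → Top i₁ → Top i₂ → E t i₁ - E t i₂ ≡ Q * (+ q * top-offset i₁ i₂ - (i₁ - i₂))
    E-at-top i₁ i₂ top₁ top₂ = begin
      E t i₁ - E t i₂
        ≡⟨ cong₂ (λ s e → - (+ q * + q * i₁) - Q * s - (+ q + + 1) * e - E t i₂) Σjs-shift (sumℤ-ks i₁) ⟩
      - (+ q * + q * i₁) - Q * (sumℤ (js t i₂) - + m * z) - (+ q + + 1) * (+ m * K i₁) - E t i₂
        ≡⟨ cong (λ e → - (+ q * + q * i₁) - Q * (sumℤ (js t i₂) - + m * z) - (+ q + + 1) * (+ m * K i₁)
                        - (- (+ q * + q * i₂) - Q * sumℤ (js t i₂) - (+ q + + 1) * e)) (sumℤ-ks i₂) ⟩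
      - (+ q * + q * i₁) - Q * (sumℤ (js t i₂) - + m * z) - (+ q + + 1) * (+ m * K i₁)
        - (- (+ q * + q * i₂) - Q * sumℤ (js t i₂) - (+ q + + 1) * (+ m * K i₂))
        ≡⟨ identity (+ m) i₁ i₂ (K i₁) (K i₂) z (sumℤ (js t i₂)) ⟩
      Q * D + H   ≡⟨ cong (λ h → Q * D + h) (X-K-at-top i₁ i₂ top₁ top₂) ⟩
      Q * D + 0ℤ  ≡⟨ ℤP.+-identityʳ (Q * D) ⟩
      Q * D       ∎
      where
      open ≡-Reasoning
      z = top-offset i₁ i₂
      D = + q * z - (i₁ - i₂)
      H = (+ q * i₁ - (+ q + + 1) * (+ m * K i₁)) - ((+ q * i₂ - (+ q + + 1) * (+ m * K i₂)) + Q * z)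
      Σjs-shift : sumℤ (js t i₁) ≡ sumℤ (js t i₂) - + m * z
      Σjs-shift = trans (cong sumℤ (VecP.map-cong shift t)) (sumℤ-map-shift (λ τ → window (- + τ) (X i₂)) z t)
        where
        shift : ∀ τ → window (- + τ) (X i₁) ≡ window (- + τ) (X i₂) - z
        shift τ = trans (cong (window (- + τ)) (X-at-top i₁ i₂ top₁ top₂)) (window-shift (- + τ) (X i₂) z)
      identity : ∀ n i₁ i₂ k₁ k₂ z s → let q = + 1 + n ; Q = q * q + q in
        - (q * q * i₁) - Q * (s - n * z) - (q + + 1) * (n * k₁) - (- (q * q * i₂) - Q * s - (q + + 1) * (n * k₂))
          ≡ Q * (q * z - (i₁ - i₂)) + ((q * i₁ - (q + + 1) * (n * k₁)) - ((q * i₂ - (q + + 1) * (n * k₂)) + Q * z))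
      identity = solve-∀

    -- The values E, X and i + Q K of two fresh points lie in common windows of
    -- length Q; the three resulting divisibility conditions H, D, W force i₁ = i₂.
    fresh-unique : ∀ i₁ i₂ → Fresh i₁ → Fresh i₂ → i₁ ≡ i₂
    fresh-unique i₁ i₂ (top₁ , E₁-window) (top₂ , E₂-window) = ℤP.i-j≡0⇒i≡j i₁ i₂ (begin
      i₁ - i₂                                            ≡⟨ combination (+ m) i₁ i₂ K₁ K₂ z ⟩
      + q * W - + q * + q * (H + + q * D + + q * W) - D  ≡⟨ lincomb-vanishes H≡0 D≡0 W≡0 ⟩
      0ℤ                                                 ∎)
      where
      open ≡-Reasoning
      K₁ = K i₁
      K₂ = K i₂
      z = top-offset i₁ i₂
      H = (+ q * i₁ - (+ q + + 1) * (+ m * K₁)) - ((+ q * i₂ - (+ q + + 1) * (+ m * K₂)) + Q * z)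
      D = + q * z - (i₁ - i₂)
      W = + q * (K₁ - K₂) + z
      H≡0 : H ≡ 0ℤ
      H≡0 = X-K-at-top i₁ i₂ top₁ top₂
      D≡0 : D ≡ 0ℤ
      D≡0 = multiple-in-window E₁-window E₂-window (E-at-top i₁ i₂ top₁ top₂)
      W≡0 : W ≡ 0ℤ
      W≡0 = multiple-in-window (window-inWindow 0ℤ i₁) (window-inWindow 0ℤ i₂) (begin
        (i₁ + Q * K₁) - (i₂ + Q * K₂)                ≡⟨ identity (+ m) i₁ i₂ K₁ K₂ z ⟩
        Q * W + (+ q * H + (+ q * + q - + 1) * D)     ≡⟨ cong₂ (λ h d → Q * W + (+ q * h + (+ q * + q - + 1) * d)) H≡0 D≡0 ⟩
        Q * W + (+ q * 0ℤ + (+ q * + q - + 1) * 0ℤ)  ≡⟨ vanish (Q * W) (+ q) ⟩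
        Q * W                                         ∎)
        where
        identity : ∀ n i₁ i₂ k₁ k₂ z → let q = + 1 + n ; Q = q * q + q in
          (i₁ + Q * k₁) - (i₂ + Q * k₂)
            ≡ Q * (q * (k₁ - k₂) + z)
              + (q * ((q * i₁ - (q + + 1) * (n * k₁)) - ((q * i₂ - (q + + 1) * (n * k₂)) + Q * z))
                 + (q * q - + 1) * (q * z - (i₁ - i₂)))
        identity = solve-∀
        vanish : ∀ x q → x + (q * 0ℤ + (q * q - + 1) * 0ℤ) ≡ x
        vanish = solve-∀
      combination : ∀ n i₁ i₂ k₁ k₂ z → let q = + 1 + n ; Q = q * q + q
                                            H = (q * i₁ - (q + + 1) * (n * k₁)) - ((q * i₂ - (q + + 1) * (n * k₂)) + Q * z)
                                            D = q * z - (i₁ - i₂) ; W = q * (k₁ - k₂) + z in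
                    i₁ - i₂ ≡ q * W - q * q * (H + q * D + q * W) - D
      combination = solve-∀
      lincomb-vanishes : ∀ {h d w} → h ≡ 0ℤ → d ≡ 0ℤ → w ≡ 0ℤ →
                         + q * w - + q * + q * (h + + q * d + + q * w) - d ≡ 0ℤ
      lincomb-vanishes refl refl refl = at-zero (+ q)
        where
        at-zero : ∀ q → q * 0ℤ - q * q * (0ℤ + q * 0ℤ + q * 0ℤ) - 0ℤ ≡ 0ℤ
        at-zero = solve-∀

    E-mono : ∀ i → E t i ≤ E t′ i
    E-mono i with X i + Q * window (- + a) (X i) ℤP.≟ C
    ... | yes top    = ℤP.≤-trans (ℤP.i≤i+j (E t i) Q) (ℤP.≤-reflexive (sym (E-step-top i top)))
    ... | no not-top = ℤP.≤-reflexive (sym (E-step-not-top i not-top))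

    module _ (t′<Q : All (ℕ._< Qn) t′) where

      a<Q : a ℕ.< Qn
      a<Q = ℕP.<⇒≤ (subst (ℕ._< Qn) (VecP.lookup∘updateAt ν t) (AllP.lookup⁺ t′<Q ν))

      C-nonneg : 0ℤ ≤ C
      C-nonneg = ≤-from-0≤ (i<j⇒0≤j-i-1 (+<+ a<Q)) (identity (+ a) Q)
        where
        identity : ∀ a Q → Q - a - + 1 ≡ (- a + Q - + 1) - 0ℤ
        identity = solve-∀

      -- i* is built backwards: K i* = C + q w and X i* ≡ C (mod Q), with N₀
      -- tuned so that E t i* = C - (q + 1) Q, which lies in [- u - Q, - u).
      σ N₀ y w Kc i* z₀ : ℤ
      σ  = sumℤ (map (λ τ → window (- + τ) C) t)
      N₀ = C - σ + + q + + 1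
      y  = (+ q + + 1) * N₀ - C
      w  = window 0ℤ y
      Kc = C + + q * w
      i* = (y + Q * w) - Q * Kc
      z₀ = N₀ - (+ q + + 1) * C - (+ q * + q - + 1) * w

      K-i* : K i* ≡ Kc
      K-i* = sym (window-unique 0ℤ i* (subst (InWindow 0ℤ) (sym (cancel (y + Q * w) Q Kc)) (window-inWindow 0ℤ y)))
        where
        cancel : ∀ x Q k → (x - Q * k) + Q * k ≡ x
        cancel = solve-∀

      X-i* : X i* ≡ C + Q * z₀
      X-i* = trans (X-K i*) (trans (cong (λ k → + q * i* - (+ q + + 1) * (+ m * k)) K-i*) (identity (+ m) C σ w))
        where
        identity : ∀ n C σ w → let q = + 1 + n ; Q = q * q + q ; N = C - σ + q + + 1 in
          q * ((((q + + 1) * N - C) + Q * w) - Q * (C + q * w)) - (q + + 1) * (n * (C + q * w))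
            ≡ C + Q * (N - (q + + 1) * C - (q * q - + 1) * w)
        identity = solve-∀

      js-i* : ∀ τ → window (- + τ) (X i*) ≡ window (- + τ) C - z₀
      js-i* τ = trans (cong (window (- + τ)) X-i*) (window-shift (- + τ) C z₀)

      window-C : window (- + a) C ≡ 0ℤ
      window-C = sym (window-unique (- + a) C
        (≤-from-0≤ (0≤i+j C-nonneg (0≤+ a)) (identity₁ (+ a) Q) , <-from-0≤ (0≤+ 0) (identity₂ (+ a) Q)))
        where
        identity₁ : ∀ a Q → (- a + Q - + 1) + a ≡ (- a + Q - + 1) + Q * 0ℤ - - a
        identity₁ = solve-∀
        identity₂ : ∀ a Q → 0ℤ ≡ (- a + Q) - ((- a + Q - + 1) + Q * 0ℤ) - + 1
        identity₂ = solve-∀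

      Top-i* : Top i*
      Top-i* = begin
        X i* + Q * window (- + a) (X i*)       ≡⟨ cong₂ (λ x v → x + Q * v) X-i* (js-i* a) ⟩
        (C + Q * z₀) + Q * (window (- + a) C - z₀) ≡⟨ cong (λ v → (C + Q * z₀) + Q * (v - z₀)) window-C ⟩
        (C + Q * z₀) + Q * (0ℤ - z₀)           ≡⟨ identity C Q z₀ ⟩
        C                                      ∎
        where
        open ≡-Reasoning
        identity : ∀ C Q z → (C + Q * z) + Q * (0ℤ - z) ≡ C
        identity = solve-∀

      E-i* : E t i* ≡ C - (+ q + + 1) * Q
      E-i* = begin
        - (+ q * + q * i*) - Q * sumℤ (js t i*) - (+ q + + 1) * sumℤ (ks i*)
          ≡⟨ cong₂ (λ s k → - (+ q * + q * i*) - Q * s - (+ q + + 1) * k) Σjs-i* (trans (sumℤ-ks i*) (cong (+ m *_) K-i*)) ⟩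
        - (+ q * + q * i*) - Q * (σ - + m * z₀) - (+ q + + 1) * (+ m * Kc)
          ≡⟨ identity (+ m) C σ w ⟩
        C - (+ q + + 1) * Q  ∎
        where
        open ≡-Reasoning
        Σjs-i* : sumℤ (js t i*) ≡ σ - + m * z₀
        Σjs-i* = trans (cong sumℤ (VecP.map-cong js-i* t)) (sumℤ-map-shift (λ τ → window (- + τ) C) z₀ t)
        identity : ∀ n C σ w → let q = + 1 + n ; Q = q * q + q ; N = C - σ + q + + 1
                                   i* = (((q + + 1) * N - C) + Q * w) - Q * (C + q * w) in
          - (q * q * i*) - Q * (σ - n * (N - (q + + 1) * C - (q * q - + 1) * w)) - (q + + 1) * (n * (C + q * w))
            ≡ C - (q + + 1) * Q
        identity = solve-∀

      fresh-i* : Fresh i*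
      fresh-i* = Top-i* , subst (InWindow (- u - Q)) (sym E-i*) (subst (λ v → InWindow (- v - Q) (C - (+ q + + 1) * Q)) (sym u≡q*Q)
        (≤-from-0≤ C-nonneg (identity₁ (+ a) (+ q) Q) , <-from-0≤ (0≤+ a) (identity₂ (+ a) (+ q) Q)))
        where
        identity₁ : ∀ a q Q → (- a + Q - + 1) ≡ ((- a + Q - + 1) - (q + + 1) * Q) - (- (q * Q) - Q)
        identity₁ = solve-∀
        identity₂ : ∀ a q Q → a ≡ (- (q * Q) - Q + Q) - ((- a + Q - + 1) - (q + + 1) * Q) - + 1
        identity₂ = solve-∀

      -r≤i* : - r ≤ i*
      -r≤i* = subst (λ v → - v ≤ i*) (sym r≡q³-q) (≤-from-0≤
        (0≤i+j (0≤i+j (ℤP.i≤j⇒0≤j-i (window-≥ 0ℤ y)) (0≤+n*i q (i<j⇒0≤j-i-1 (window-< 0ℤ y))))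
               (0≤i+j (0≤+n*i Qn (ℤP.i≤j⇒0≤j-i σ≤0)) (0≤i+j (0≤+n*i q (0≤+ a)) (0≤i+j (0≤+ q) (0≤+ q)))))
        (identity (+ m) (+ a) σ w))
        where
        σ≤0 : σ ≤ 0ℤ
        σ≤0 = sumℤ-map-nonPos (λ τ → window (- + τ) C) (λ τ → window-nonPos (ℤP.neg-mono-≤ (0≤+ τ)) C-nonneg) t
        identity : ∀ n a σ w → let q = + 1 + n ; Q = q * q + q ; C = - a + Q - + 1 ; N = C - σ + q + + 1
                                   ρ = ((q + + 1) * N - C) + Q * w in
          ((ρ - 0ℤ) + q * ((0ℤ + Q) - ρ - + 1)) + (Q * (0ℤ - σ) + (q * a + (q + q)))
            ≡ (ρ - Q * (C + q * w)) - - (q * q * q - q)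
        identity = solve-∀

      count-increment : #Admissible t′ ≡ suc (#Admissible t)
      count-increment = count-at-suc (Admissible? t) (Admissible? t′) (Admissible-inside t′<Q)
        (proj₁ (fresh⇒new-admissible -r≤i* fresh-i*)) (proj₂ (fresh⇒new-admissible -r≤i* fresh-i*))
        (λ i (-r≤i , -u≤E) → -r≤i , ℤP.≤-trans -u≤E (E-mono i))
        old-admissible
        where
        old-admissible : ∀ i → i ≢ i* → Admissible t′ i → Admissible t i
        old-admissible i i≢i* adm′ with Admissible? t i
        ... | yes adm = adm
        ... | no ¬adm = contradiction (fresh-unique i i* (new-admissible⇒fresh adm′ ¬adm) fresh-i*) i≢i*

  #Admissible-sum : ∀ m (t : Vec ℕ m) → All (ℕ._< Geometry.Qn m) t →
                    Geometry.#Admissible m t ≡ Geometry.#Admissible m (replicate m 0) ℕ.+ sum t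
  #Admissible-sum m t t<Q = by-sum (sum t) t refl t<Q
    where
    open Geometry m
    by-sum : ∀ N (t : Vec ℕ m) → sum t ≡ N → All (ℕ._< Qn) t → #Admissible t ≡ #Admissible (replicate m 0) ℕ.+ N
    by-sum zero t Σt≡0 _ = trans (cong #Admissible (sum≡0⇒replicate t Σt≡0)) (sym (ℕP.+-identityʳ _))
    by-sum (suc N) t Σt≡1+N t<Q with sum≡suc⇒updateAt t Σt≡1+N
    ... | t₀ , ν , refl = begin
      #Admissible (updateAt t₀ ν suc)            ≡⟨ Increment.count-increment m t₀ ν t<Q ⟩
      suc (#Admissible t₀)                        ≡⟨ cong suc (by-sum N t₀ Σt₀≡N (All-<-updateAt-suc⁻ t₀ ν t<Q)) ⟩
      suc (#Admissible (replicate m 0) ℕ.+ N)     ≡⟨ ℕP.+-suc _ N ⟨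
      #Admissible (replicate m 0) ℕ.+ suc N       ∎
      where
      open ≡-Reasoning
      Σt₀≡N : sum t₀ ≡ N
      Σt₀≡N = ℕP.suc-injective (trans (sym (sum-updateAt-suc t₀ ν)) Σt≡1+N)

open LatticePoints using (module Geometry; #Admissible-sum)
open import Data.Nat.Primality using (Prime; ¬prime[0])
open import Data.Nat using (_∸_; _+_; _*_; _<_)
open import Data.Integer using (+_; 0ℤ)

lemma3p8 : (q : ℕ) → IsPrimePower q → (t : Vec ℕ (q ∸ 1)) →
    All (λ tν → tν < q * q + q) t →
    Σ ℕ (λ M →
      HasCard (Ω q (rStar q) (replicate (q ∸ 1) 0ℤ) (replicate (q ∸ 1) 0ℤ) (uStar q)) M
      × HasCard (Ω q (rStar q) (replicate (q ∸ 1) 0ℤ) (map +_ t) (uStar q)) (M + sum t))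
lemma3p8 zero (p , k , p-prime , 0≡p^k+1) _ _ =
  ⊥-elim (¬prime[0] (subst Prime (ℕP.m^n≡0⇒m≡0 p (suc k) (sym 0≡p^k+1)) p-prime))
lemma3p8 (suc m) _ t t<Q = #Admissible (replicate m 0) , card-zero , card-t
  where
  open Geometry m
  card-zero : HasCard (Ω q r zeros zeros u) (#Admissible (replicate m 0))
  card-zero = subst (λ v → HasCard (Ω q r zeros v u) (#Admissible (replicate m 0))) (VecP.map-replicate +_ 0 m)
                (Ω-card (AllP.lookup⁻ (λ ν → subst (ℕ._< Qn) (sym (VecP.lookup-replicate ν 0)) (ℕ.s≤s ℕ.z≤n))))
  card-t : HasCard (Ωₜ t) (#Admissible (replicate m 0) + sum t)
  card-t = subst (HasCard (Ωₜ t)) (#Admissible-sum m t t<Q) (Ω-card t<Q)
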